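{- Let $n,j$ be positive integers. The circulant graph $\Gamma(n,\pm\{1,2,\dots,j\})$ is not Fibonacci cordial in each of the following cases: (1) $j\equiv 2\pmod 4$ and $n\equiv 1\pmod 2$; (2) $j\equiv 3\pmod 4$ and $n\equiv 2\pmod 4$.
   Context: The Fibonacci numbers are defined by $F_0=0$, $F_1=F_2=1$, $F_n=F_{n-1}+F_{n-2}$. For a graph $G$ with $N$ vertices, a Fibonacci cordial labeling is an injective function $f:V(G)\to\{F_0,F_1,\dots,F_N\}$ (labels $F_i$ with distinct indices are regarded as distinct labels) such that the induced edge labeling $f^*(uv)=(f(u)+f(v)) \bmod 2$ satisfies $|\varepsilon_0-\varepsilon_1|\le 1$, where $\varepsilon_i$ is the number of edges labeled $i$. A graph admitting such a labeling is called Fibonacci cordial. For $S\subset\mathbb{Z}_n$ with $0\notin S$ and $S=-S$, the circulant graph $\Gamma(n,S)$ has vertex set $\mathbb{Z}_n$ and edges $\{u,v\}$ with $v-u\in S$; $\pm\{1,\dots,j\}$ denotes $\{\pm1,\dots,\pm j\}\subset\mathbb{Z}_n$. -}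

module Defs where

open import Data.Nat using (ℕ; zero; suc; _+_; _≤_; _≡ᵇ_)
open import Data.Nat.DivMod using (_%_)
open import Data.Nat.Properties using (_<?_; _≟_)
open import Data.Fin using (Fin; toℕ)
open import Data.Bool using (Bool; T; _∨_)
open import Data.Bool.Properties using (T?)
open import Data.List using (List; length; filter; map; concatMap; upTo; allFin)
open import Data.Bool.ListAction using (any)
open import Data.Product using (Σ; _×_; _,_; proj₁; proj₂)
open import Function.Definitions using (Injective)
open import Relation.Binary.PropositionalEquality using (_≡_)

fib : ℕ → ℕ
fib zero = zero
fib (suc zero) = suc zero
fib (suc (suc n)) = fib (suc n) + fib n

-- A finite simple graph on vertex set Fin N, given by a symmetric,
-- irreflexive Boolean adjacency relation (symmetry/irreflexivity are not
-- needed for the definitions below; edges are read off from pairs u < v).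
record Graph : Set where
  field
    N   : ℕ
    adj : Fin N → Fin N → Bool
open Graph public

orderedPairs : (N : ℕ) → List (Fin N × Fin N)
orderedPairs N =
  concatMap (λ u → map (λ v → (u , v)) (filter (λ v → toℕ u <? toℕ v) (allFin N))) (allFin N)

edges : (G : Graph) → List (Fin (N G) × Fin (N G))
edges G = filter (λ e → T? (adj G (proj₁ e) (proj₂ e))) (orderedPairs (N G))

-- A vertex labeling by Fibonacci numbers: f v is the INDEX i of the label F_i,
-- an element of {0,…,N}; the label value is fib (toℕ (f v)).
FibLabeling : Graph → Set
FibLabeling G = Fin (N G) → Fin (suc (N G))

edgeLabel : (G : Graph) → FibLabeling G → Fin (N G) × Fin (N G) → ℕ
edgeLabel G f e = (fib (toℕ (f (proj₁ e))) + fib (toℕ (f (proj₂ e)))) % 2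

ε : (G : Graph) → FibLabeling G → ℕ → ℕ
ε G f i = length (filter (λ e → edgeLabel G f e ≟ i) (edges G))

IsFibonacciCordialLabeling : (G : Graph) → FibLabeling G → Set
IsFibonacciCordialLabeling G f =
  Injective _≡_ _≡_ f × (ε G f 0 ≤ suc (ε G f 1)) × (ε G f 1 ≤ suc (ε G f 0))

FibonacciCordial : Graph → Set
FibonacciCordial G = Σ (FibLabeling G) (IsFibonacciCordialLabeling G)

-- Circulant graph Γ(n, ±{1,…,j}) on vertex set ℤ_n = Fin n:
-- u ~ v iff v - u ≡ d or v - u ≡ -d (mod n) for some d ∈ {1,…,j}.
circAdj : (n j : ℕ) → Fin n → Fin n → Bool
circAdj zero j () v
circAdj (suc m) j u v =
  any (λ d → ((toℕ u + d) % suc m ≡ᵇ toℕ v) ∨ ((toℕ v + d) % suc m ≡ᵇ toℕ u))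
      (map suc (upTo j))

circulant : (n j : ℕ) → Graph
circulant n j = record { N = n ; adj = circAdj n j }

{-# OPTIONS --safe #-}
module Submission where

-- For 2j < n the edges of Γ(n, ±{1,…,j}) are exactly the nj pairs {u, u + d} with u ∈ ℤ_n and
-- 1 ≤ d ≤ j, each listed once. Summing the labels of the two ends over these pairs counts every
-- vertex label 2j times, so for any vertex labelling whatsoever the number ε₁ of odd edges is even
-- (neither injectivity nor the Fibonacci values play a role). In both cases nj ≡ 2 (mod 4), so
-- ε₀ + ε₁ = nj is even and |ε₀ − ε₁| ≤ 1 forces ε₀ = ε₁; then nj = 2ε₁ ≡ 0 (mod 4).

open import Data.Bool using (Bool; true; false; _∨_)
open import Data.Bool.ListAction using (any)
open import Data.Bool.Properties using (T?)
open import Data.Empty using (⊥-elim)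
open import Data.Fin using (Fin; toℕ)
open import Data.Fin.Properties using (toℕ<n; toℕ-injective; toℕ-fromℕ<)
open import Data.List using (List; []; _∷_; _++_; map; filter; concatMap; allFin; upTo; applyUpTo; tabulate; length)
open import Data.List.Properties using (map-∘; map-cong; map-++; map-tabulate; map-upTo; map-applyUpTo)
open import Data.Nat using (ℕ; zero; suc; _+_; _*_; _∸_; _≤_; _<_; _≡ᵇ_; NonZero; z≤n; s≤s; s≤s⁻¹; z<s; s<s)
open import Data.Nat.Divisibility using (divides)
open import Data.Nat.DivMod
  using (_%_; _mod_; _/_; m<n⇒m%n≡m; m%n<n; m%n%n≡m%n; n%n≡0; %-distribˡ-+; %-distribˡ-*; m≤n⇒[n∸m]%m≡n%m;
         [m+kn]%n≡m%n; m*n%n≡0; m≡m%n+[m/n]*n; m∣n⇒o%n%m≡o%m)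
open import Data.Nat.ListAction using (sum)
open import Data.Nat.ListAction.Properties using (sum-++)
open import Data.Nat.Properties
open import Algebra.Properties.CommutativeSemigroup +-commutativeSemigroup using (interchange)
open import Data.Product using (_×_; _,_; proj₁; proj₂)
open import Data.Sum using (_⊎_; inj₁; inj₂)
open import Defs
open import Function using (_∘_; id)
open import Function.Bundles using (mk⇔)
open import Relation.Binary.Definitions using (tri<; tri≈; tri>)
open import Relation.Binary.PropositionalEquality
  using (_≡_; _≢_; refl; sym; trans; cong; cong₂; subst; module ≡-Reasoning)
open import Relation.Nullary using (¬_; Dec; yes; no; does)
open import Relation.Nullary.Decidable using (dec-false; does-⇔)
open import Relation.Unary using (Decidable)
open ≡-Reasoning

-- On ℕ, `does (m ≟ n)` computes to `m ≡ᵇ n`, so Dec-lemmas such as ⟦does⟧≡0 also apply to ⟦ m ≡ᵇ n ⟧.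
⟦_⟧ : Bool → ℕ
⟦ true  ⟧ = 1
⟦ false ⟧ = 0

⟦does⟧≡0 : ∀ {p} {P : Set p} (P? : Dec P) → ¬ P → ⟦ does P? ⟧ ≡ 0
⟦does⟧≡0 P? ¬p = cong ⟦_⟧ (dec-false P? ¬p)

⟦does⟧*-cong : ∀ {p} {P : Set p} (P? : Dec P) {x y} → (P → x ≡ y) → ⟦ does P? ⟧ * x ≡ ⟦ does P? ⟧ * y
⟦does⟧*-cong (yes p) x≡y = cong (1 *_) (x≡y p)
⟦does⟧*-cong (no _)  _   = refl

⟦does⟧+⟦does⟧≤1 : ∀ {p q} {P : Set p} {Q : Set q} (P? : Dec P) (Q? : Dec Q) →
                  ¬ (P × Q) → ⟦ does P? ⟧ + ⟦ does Q? ⟧ ≤ 1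
⟦does⟧+⟦does⟧≤1 (yes p) (yes q) ¬pq = ⊥-elim (¬pq (p , q))
⟦does⟧+⟦does⟧≤1 (yes _) (no _)  _   = ≤-refl
⟦does⟧+⟦does⟧≤1 (no _)  (yes _) _   = ≤-refl
⟦does⟧+⟦does⟧≤1 (no _)  (no _)  _   = z≤n

⟦<⟧+⟦>⟧+⟦≡⟧ : ∀ a b → ⟦ does (a <? b) ⟧ + ⟦ does (b <? a) ⟧ + ⟦ a ≡ᵇ b ⟧ ≡ 1
⟦<⟧+⟦>⟧+⟦≡⟧ zero    zero    = refl
⟦<⟧+⟦>⟧+⟦≡⟧ zero    (suc b) = refl
⟦<⟧+⟦>⟧+⟦≡⟧ (suc a) zero    = refl
⟦<⟧+⟦>⟧+⟦≡⟧ (suc a) (suc b) = ⟦<⟧+⟦>⟧+⟦≡⟧ a b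

-- Finite sums ∑[ k < n ] over ℕ

∑ : ℕ → (ℕ → ℕ) → ℕ
∑ n h = sum (applyUpTo h n)

syntax ∑ n (λ k → e) = ∑[ k < n ] e

∑-cong : ∀ n {h h′ : ℕ → ℕ} → (∀ k → k < n → h k ≡ h′ k) → ∑ n h ≡ ∑ n h′
∑-cong zero    _  = refl
∑-cong (suc n) eq = cong₂ _+_ (eq 0 z<s) (∑-cong n (λ k k<n → eq (suc k) (s<s k<n)))

∑-zero : ∀ n → ∑[ k < n ] 0 ≡ 0
∑-zero zero    = refl
∑-zero (suc n) = ∑-zero n

∑-const : ∀ n c → ∑[ k < n ] c ≡ n * c
∑-const zero    c = refl
∑-const (suc n) c = cong (c +_) (∑-const n c)

∑-last : ∀ n (h : ℕ → ℕ) → ∑ (suc n) h ≡ ∑ n h + h n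
∑-last zero    h = +-identityʳ (h 0)
∑-last (suc n) h = trans (cong (h 0 +_) (∑-last n (h ∘ suc))) (sym (+-assoc (h 0) _ _))

∑-distrib-+ : ∀ n (h h′ : ℕ → ℕ) → ∑[ k < n ] (h k + h′ k) ≡ ∑ n h + ∑ n h′
∑-distrib-+ zero    h h′ = refl
∑-distrib-+ (suc n) h h′ =
  trans (cong (h 0 + h′ 0 +_) (∑-distrib-+ n (h ∘ suc) (h′ ∘ suc))) (interchange (h 0) (h′ 0) _ _)

∑∑-distrib-+ : ∀ m n (M M′ : ℕ → ℕ → ℕ) →
  ∑[ a < m ] ∑[ b < n ] (M a b + M′ a b) ≡ ∑[ a < m ] ∑[ b < n ] M a b + ∑[ a < m ] ∑[ b < n ] M′ a b
∑∑-distrib-+ m n M M′ = trans (∑-cong m (λ a _ → ∑-distrib-+ n (M a) (M′ a))) (∑-distrib-+ m _ _)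

*-distribʳ-∑ : ∀ n (h : ℕ → ℕ) c → ∑ n h * c ≡ ∑[ k < n ] (h k * c)
*-distribʳ-∑ zero    h c = refl
*-distribʳ-∑ (suc n) h c = trans (*-distribʳ-+ c (h 0) _) (cong (h 0 * c +_) (*-distribʳ-∑ n (h ∘ suc) c))

∑-comm : ∀ m n (M : ℕ → ℕ → ℕ) → ∑[ a < m ] ∑[ b < n ] M a b ≡ ∑[ b < n ] ∑[ a < m ] M a b
∑-comm zero    n M = sym (∑-zero n)
∑-comm (suc m) n M =
  trans (cong (∑[ b < n ] M 0 b +_) (∑-comm m n (M ∘ suc))) (sym (∑-distrib-+ n (M 0) _))

∑-% : ∀ n (h : ℕ → ℕ) d .{{_ : NonZero d}} → ∑[ k < n ] (h k % d) % d ≡ ∑ n h % d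
∑-% zero    h d = refl
∑-% (suc n) h d = begin
  (h 0 % d + ∑[ k < n ] (h (suc k) % d)) % d
    ≡⟨ %-distribˡ-+ (h 0 % d) _ d ⟩
  (h 0 % d % d + ∑[ k < n ] (h (suc k) % d) % d) % d
    ≡⟨ cong₂ (λ x y → (x + y) % d) (m%n%n≡m%n (h 0) d) (∑-% n (h ∘ suc) d) ⟩
  (h 0 % d + ∑ n (h ∘ suc) % d) % d
    ≡⟨ sym (%-distribˡ-+ (h 0) _ d) ⟩
  (h 0 + ∑ n (h ∘ suc)) % d ∎

∑∑-% : ∀ m n (M : ℕ → ℕ → ℕ) d .{{_ : NonZero d}} →
  ∑[ a < m ] ∑[ b < n ] (M a b % d) % d ≡ ∑[ a < m ] ∑[ b < n ] M a b % d
∑∑-% m n M d = begin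
  ∑[ a < m ] ∑[ b < n ] (M a b % d) % d       ≡⟨ sym (∑-% m (λ a → ∑[ b < n ] (M a b % d)) d) ⟩
  ∑[ a < m ] (∑[ b < n ] (M a b % d) % d) % d ≡⟨ cong (_% d) (∑-cong m (λ a _ → ∑-% n (M a) d)) ⟩
  ∑[ a < m ] (∑[ b < n ] M a b % d) % d       ≡⟨ ∑-% m (λ a → ∑[ b < n ] M a b) d ⟩
  ∑[ a < m ] ∑[ b < n ] M a b % d             ∎

∑-delta : ∀ n k (h : ℕ → ℕ) → k < n → ∑[ v < n ] (⟦ k ≡ᵇ v ⟧ * h v) ≡ h k
∑-delta (suc n) zero    h _         =
  trans (cong (h 0 + 0 +_) (∑-zero n)) (trans (+-identityʳ _) (+-identityʳ (h 0)))
∑-delta (suc n) (suc k) h (s<s k<n) = ∑-delta n k (h ∘ suc) k<n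

∑-count : ∀ n k → ∑[ v < n ] ⟦ k ≡ᵇ v ⟧ ≡ ⟦ does (k <? n) ⟧
∑-count zero    k       = refl
∑-count (suc n) zero    = cong suc (∑-zero n)
∑-count (suc n) (suc k) = ∑-count n k

∑∑-split-diagonal : ∀ n (M : ℕ → ℕ → ℕ) →
  ∑[ a < n ] ∑[ b < n ] M a b ≡
  ∑[ a < n ] ∑[ b < n ] (⟦ does (a <? b) ⟧ * (M a b + M b a)) + ∑[ a < n ] M a a
∑∑-split-diagonal n M = begin
  ∑[ a < n ] ∑[ b < n ] M a b
    ≡⟨ ∑-cong n (λ a _ → ∑-cong n (λ b _ → split-by-order a b)) ⟩
  ∑[ a < n ] ∑[ b < n ] (below a b + above a b + diagonal a b)
    ≡⟨ ∑∑-distrib-+ n n (λ a b → below a b + above a b) diagonal ⟩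
  ∑[ a < n ] ∑[ b < n ] (below a b + above a b) + ∑[ a < n ] ∑[ b < n ] diagonal a b
    ≡⟨ cong₂ _+_ (∑∑-distrib-+ n n below above) (∑-cong n (λ a a<n → ∑-delta n a (M a) a<n)) ⟩
  ∑[ a < n ] ∑[ b < n ] below a b + ∑[ a < n ] ∑[ b < n ] above a b + ∑[ a < n ] M a a
    ≡⟨ cong (λ x → ∑[ a < n ] ∑[ b < n ] below a b + x + ∑[ a < n ] M a a) (∑-comm n n above) ⟩
  ∑[ a < n ] ∑[ b < n ] below a b + ∑[ a < n ] ∑[ b < n ] above b a + ∑[ a < n ] M a a
    ≡⟨ cong (_+ ∑[ a < n ] M a a) (sym (∑∑-distrib-+ n n below (λ a b → above b a))) ⟩
  ∑[ a < n ] ∑[ b < n ] (below a b + above b a) + ∑[ a < n ] M a a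
    ≡⟨ cong (_+ ∑[ a < n ] M a a) (∑-cong n (λ a _ → ∑-cong n (λ b _ →
         sym (*-distribˡ-+ ⟦ does (a <? b) ⟧ (M a b) (M b a))))) ⟩
  ∑[ a < n ] ∑[ b < n ] (⟦ does (a <? b) ⟧ * (M a b + M b a)) + ∑[ a < n ] M a a ∎
  where
  below above diagonal : ℕ → ℕ → ℕ
  below    a b = ⟦ does (a <? b) ⟧ * M a b
  above    a b = ⟦ does (b <? a) ⟧ * M a b
  diagonal a b = ⟦ a ≡ᵇ b ⟧ * M a b

  split-by-order : ∀ a b → M a b ≡ below a b + above a b + diagonal a b
  split-by-order a b = begin
    M a b                                    ≡⟨ sym (*-identityˡ (M a b)) ⟩
    1 * M a b                                ≡⟨ cong (λ x → x * M a b) (sym (⟦<⟧+⟦>⟧+⟦≡⟧ a b)) ⟩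
    (⟦ does (a <? b) ⟧ + ⟦ does (b <? a) ⟧ + ⟦ a ≡ᵇ b ⟧) * M a b
      ≡⟨ *-distribʳ-+ (M a b) (⟦ does (a <? b) ⟧ + ⟦ does (b <? a) ⟧) ⟦ a ≡ᵇ b ⟧ ⟩
    (⟦ does (a <? b) ⟧ + ⟦ does (b <? a) ⟧) * M a b + diagonal a b
      ≡⟨ cong (_+ diagonal a b) (*-distribʳ-+ (M a b) ⟦ does (a <? b) ⟧ ⟦ does (b <? a) ⟧) ⟩
    below a b + above a b + diagonal a b ∎

∑-rotate : ∀ n .{{_ : NonZero n}} k (H : ℕ → ℕ) → ∑[ u < n ] H ((u + k) % n) ≡ ∑ n H
∑-rotate n zero    H = ∑-cong n (λ u u<n → cong H (trans (cong (_% n) (+-identityʳ u)) (m<n⇒m%n≡m u<n)))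
∑-rotate n (suc k) H = begin
  ∑[ u < n ] H ((u + suc k) % n)       ≡⟨ ∑-cong n (λ u _ → cong H (shift-out u)) ⟩
  ∑[ u < n ] H′ ((u + 1) % n)          ≡⟨ rotate-by-one n H′ ⟩
  ∑ n H′                               ≡⟨ ∑-rotate n k H ⟩
  ∑ n H                                ∎
  where
  H′ : ℕ → ℕ
  H′ w = H ((w + k) % n)

  shift-out : ∀ u → (u + suc k) % n ≡ ((u + 1) % n + k) % n
  shift-out u = begin
    (u + suc k) % n              ≡⟨ cong (_% n) (sym (+-assoc u 1 k)) ⟩
    (u + 1 + k) % n              ≡⟨ %-distribˡ-+ (u + 1) k n ⟩
    ((u + 1) % n + k % n) % n    ≡⟨ cong (λ t → (t + k % n) % n) (sym (m%n%n≡m%n (u + 1) n)) ⟩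
    ((u + 1) % n % n + k % n) % n ≡⟨ sym (%-distribˡ-+ ((u + 1) % n) k n) ⟩
    ((u + 1) % n + k) % n        ∎

  rotate-by-one : ∀ n .{{_ : NonZero n}} (G : ℕ → ℕ) → ∑[ u < n ] G ((u + 1) % n) ≡ ∑ n G
  rotate-by-one n@(suc m) G = begin
    ∑[ u < n ] G ((u + 1) % n)             ≡⟨ ∑-last m _ ⟩
    ∑[ u < m ] G ((u + 1) % n) + G ((m + 1) % n)
      ≡⟨ cong₂ _+_ (∑-cong m (λ u u<m → cong G (trans (cong (_% n) (+-comm u 1)) (m<n⇒m%n≡m (s<s u<m)))))
                   (cong G (trans (cong (_% n) (+-comm m 1)) (n%n≡0 n))) ⟩
    ∑[ u < m ] G (suc u) + G 0             ≡⟨ +-comm _ (G 0) ⟩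
    ∑ n G                                  ∎

-- Edge counts of a graph

module _ {a p} {A : Set a} {P : A → Set p} (P? : Decidable P) where

  length-filter : ∀ xs → length (filter P? xs) ≡ sum (map (λ x → ⟦ does (P? x) ⟧) xs)
  length-filter []       = refl
  length-filter (x ∷ xs) with does (P? x)
  ... | true  = cong suc (length-filter xs)
  ... | false = length-filter xs

  sum-map-filter : ∀ (h : A → ℕ) xs →
    sum (map h (filter P? xs)) ≡ sum (map (λ x → ⟦ does (P? x) ⟧ * h x) xs)
  sum-map-filter h []       = refl
  sum-map-filter h (x ∷ xs) with does (P? x)
  ... | true  = cong₂ _+_ (sym (+-identityʳ (h x))) (sum-map-filter h xs)
  ... | false = sum-map-filter h xs

sum-map-concatMap : ∀ {a b} {A : Set a} {B : Set b} (h : B → ℕ) (f : A → List B) xs →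
  sum (map h (concatMap f xs)) ≡ sum (map (λ x → sum (map h (f x))) xs)
sum-map-concatMap h f []       = refl
sum-map-concatMap h f (x ∷ xs) = begin
  sum (map h (f x ++ concatMap f xs))
    ≡⟨ cong sum (map-++ h (f x) (concatMap f xs)) ⟩
  sum (map h (f x) ++ map h (concatMap f xs))
    ≡⟨ sum-++ (map h (f x)) _ ⟩
  sum (map h (f x)) + sum (map h (concatMap f xs))
    ≡⟨ cong (sum (map h (f x)) +_) (sum-map-concatMap h f xs) ⟩
  sum (map h (f x)) + sum (map (λ x → sum (map h (f x))) xs) ∎

sum-tabulate : ∀ n (h : ℕ → ℕ) → sum (tabulate {n = n} (h ∘ toℕ)) ≡ ∑ n h
sum-tabulate zero    h = refl
sum-tabulate (suc n) h = cong (h 0 +_) (sum-tabulate n (h ∘ suc))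

sum-map-allFin : ∀ n (h : ℕ → ℕ) → sum (map (h ∘ toℕ) (allFin n)) ≡ ∑ n h
sum-map-allFin n h = trans (cong sum (map-tabulate {n = n} id (h ∘ toℕ))) (sum-tabulate n h)

sum-map-suc-upTo : ∀ n (h : ℕ → ℕ) → sum (map h (map suc (upTo n))) ≡ ∑[ d < n ] h (suc d)
sum-map-suc-upTo n h = cong sum (trans (cong (map h) (map-upTo suc n)) (map-applyUpTo suc h n))

⟦any-∨⟧ : ∀ {a} {A : Set a} (q r : A → Bool) xs →
  sum (map (λ x → ⟦ q x ⟧ + ⟦ r x ⟧) xs) ≤ 1 →
  ⟦ any (λ x → q x ∨ r x) xs ⟧ ≡ sum (map (λ x → ⟦ q x ⟧ + ⟦ r x ⟧) xs)
⟦any-∨⟧ q r []       _  = refl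
⟦any-∨⟧ q r (x ∷ xs) ≤1 with q x | r x
... | true  | true  = ⊥-elim (1+n≰n (≤-trans (s≤s (s≤s z≤n)) ≤1))
... | true  | false = cong suc (sym (n≤0⇒n≡0 (s≤s⁻¹ ≤1)))
... | false | true  = cong suc (sym (n≤0⇒n≡0 (s≤s⁻¹ ≤1)))
... | false | false = ⟦any-∨⟧ q r xs ≤1

sum-orderedPairs : ∀ N (w : ℕ → ℕ → ℕ) →
  sum (map (λ e → w (toℕ (proj₁ e)) (toℕ (proj₂ e))) (orderedPairs N)) ≡
  ∑[ a < N ] ∑[ b < N ] (⟦ does (a <? b) ⟧ * w a b)
sum-orderedPairs N w = begin
  sum (map W (orderedPairs N))
    ≡⟨ sum-map-concatMap W _ (allFin N) ⟩
  sum (map (λ u → sum (map W (map (u ,_) (later u)))) (allFin N))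
    ≡⟨ cong sum (map-cong row (allFin N)) ⟩
  sum (map (λ u → ∑[ b < N ] (⟦ does (toℕ u <? b) ⟧ * w (toℕ u) b)) (allFin N))
    ≡⟨ sum-map-allFin N (λ a → ∑[ b < N ] (⟦ does (a <? b) ⟧ * w a b)) ⟩
  ∑[ a < N ] ∑[ b < N ] (⟦ does (a <? b) ⟧ * w a b) ∎
  where
  W : Fin N × Fin N → ℕ
  W e = w (toℕ (proj₁ e)) (toℕ (proj₂ e))

  later : Fin N → List (Fin N)
  later u = filter (λ v → toℕ u <? toℕ v) (allFin N)

  row : ∀ u → sum (map W (map (u ,_) (later u))) ≡ ∑[ b < N ] (⟦ does (toℕ u <? b) ⟧ * w (toℕ u) b)
  row u = begin
    sum (map W (map (u ,_) (later u)))
      ≡⟨ cong sum (sym (map-∘ (later u))) ⟩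
    sum (map (w (toℕ u) ∘ toℕ) (later u))
      ≡⟨ sum-map-filter (λ v → toℕ u <? toℕ v) (w (toℕ u) ∘ toℕ) (allFin N) ⟩
    sum (map (λ v → ⟦ does (toℕ u <? toℕ v) ⟧ * w (toℕ u) (toℕ v)) (allFin N))
      ≡⟨ sum-map-allFin N (λ b → ⟦ does (toℕ u <? b) ⟧ * w (toℕ u) b) ⟩
    ∑[ b < N ] (⟦ does (toℕ u <? b) ⟧ * w (toℕ u) b) ∎

edgeLabelIs : (F : ℕ → ℕ) → ℕ → ℕ → ℕ → ℕ
edgeLabelIs F i a b = ⟦ does ((F a + F b) % 2 ≟ i) ⟧

edgeLabelIs-sym : ∀ F i a b → edgeLabelIs F i a b ≡ edgeLabelIs F i b a
edgeLabelIs-sym F i a b = cong (λ x → ⟦ does (x % 2 ≟ i) ⟧) (+-comm (F a) (F b))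

edgeLabelIs-0+1 : ∀ F a b → edgeLabelIs F 0 a b + edgeLabelIs F 1 a b ≡ 1
edgeLabelIs-0+1 F a b with (F a + F b) % 2 | m%n<n (F a + F b) 2
... | 0           | _                 = refl
... | 1           | _                 = refl
... | suc (suc _) | s≤s (s≤s ())

edgeLabelIs-1 : ∀ F a b → edgeLabelIs F 1 a b ≡ (F a + F b) % 2
edgeLabelIs-1 F a b with (F a + F b) % 2 | m%n<n (F a + F b) 2
... | 0           | _                 = refl
... | 1           | _                 = refl
... | suc (suc _) | s≤s (s≤s ())

module _ (G : Graph) (adjℕ : ℕ → ℕ → Bool) (adj≗ : ∀ u v → adj G u v ≡ adjℕ (toℕ u) (toℕ v)) where

  sum-edges : ∀ (w : ℕ → ℕ → ℕ) →
    sum (map (λ e → w (toℕ (proj₁ e)) (toℕ (proj₂ e))) (edges G)) ≡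
    ∑[ a < N G ] ∑[ b < N G ] (⟦ does (a <? b) ⟧ * (⟦ adjℕ a b ⟧ * w a b))
  sum-edges w = begin
    sum (map W (edges G))
      ≡⟨ sum-map-filter (λ e → T? (adj G (proj₁ e) (proj₂ e))) W (orderedPairs (N G)) ⟩
    sum (map (λ e → ⟦ adj G (proj₁ e) (proj₂ e) ⟧ * W e) (orderedPairs (N G)))
      ≡⟨ cong sum (map-cong (λ (u , v) → cong (λ x → ⟦ x ⟧ * W (u , v)) (adj≗ u v)) (orderedPairs (N G))) ⟩
    sum (map (λ e → ⟦ adjℕ (toℕ (proj₁ e)) (toℕ (proj₂ e)) ⟧ * W e) (orderedPairs (N G)))
      ≡⟨ sum-orderedPairs (N G) (λ a b → ⟦ adjℕ a b ⟧ * w a b) ⟩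
    ∑[ a < N G ] ∑[ b < N G ] (⟦ does (a <? b) ⟧ * (⟦ adjℕ a b ⟧ * w a b)) ∎
    where
    W : Fin (N G) × Fin (N G) → ℕ
    W e = w (toℕ (proj₁ e)) (toℕ (proj₂ e))

  ε≡∑ : (f : FibLabeling G) (F : ℕ → ℕ) → (∀ u → fib (toℕ (f u)) ≡ F (toℕ u)) → ∀ i →
    ε G f i ≡ ∑[ a < N G ] ∑[ b < N G ] (⟦ does (a <? b) ⟧ * (⟦ adjℕ a b ⟧ * edgeLabelIs F i a b))
  ε≡∑ f F F≗ i = begin
    ε G f i
      ≡⟨ length-filter (λ e → edgeLabel G f e ≟ i) (edges G) ⟩
    sum (map (λ e → ⟦ does (edgeLabel G f e ≟ i) ⟧) (edges G))
      ≡⟨ cong sum (map-cong (λ (u , v) → cong₂ (λ x y → ⟦ does ((x + y) % 2 ≟ i) ⟧) (F≗ u) (F≗ v))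
                            (edges G)) ⟩
    sum (map (λ e → edgeLabelIs F i (toℕ (proj₁ e)) (toℕ (proj₂ e))) (edges G))
      ≡⟨ sum-edges (edgeLabelIs F i) ⟩
    ∑[ a < N G ] ∑[ b < N G ] (⟦ does (a <? b) ⟧ * (⟦ adjℕ a b ⟧ * edgeLabelIs F i a b)) ∎

-- The circulant graph Γ(n, ±{1,…,j})

⟦%≡⟧-split : ∀ n .{{_ : NonZero n}} x b → x < n + n → b < n →
  ⟦ x % n ≡ᵇ b ⟧ ≡ ⟦ x ≡ᵇ b ⟧ + ⟦ x ≡ᵇ b + n ⟧
⟦%≡⟧-split n x b x<2n b<n with x <? n
... | yes x<n = begin
  ⟦ x % n ≡ᵇ b ⟧               ≡⟨ cong (λ y → ⟦ y ≡ᵇ b ⟧) (m<n⇒m%n≡m x<n) ⟩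
  ⟦ x ≡ᵇ b ⟧                   ≡⟨ sym (+-identityʳ _) ⟩
  ⟦ x ≡ᵇ b ⟧ + 0               ≡⟨ cong (⟦ x ≡ᵇ b ⟧ +_) (sym (⟦does⟧≡0 (x ≟ b + n) x≢b+n)) ⟩
  ⟦ x ≡ᵇ b ⟧ + ⟦ x ≡ᵇ b + n ⟧ ∎
  where
  x≢b+n : x ≢ b + n
  x≢b+n x≡b+n = <-irrefl x≡b+n (<-≤-trans x<n (m≤n+m n b))
... | no x≮n = begin
  ⟦ x % n ≡ᵇ b ⟧               ≡⟨ cong (λ y → ⟦ y ≡ᵇ b ⟧) (sym x∸n≡x%n) ⟩
  ⟦ x ∸ n ≡ᵇ b ⟧               ≡⟨ cong ⟦_⟧ (does-⇔ (mk⇔ to from) (x ∸ n ≟ b) (x ≟ b + n)) ⟩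
  ⟦ x ≡ᵇ b + n ⟧               ≡⟨ cong (_+ ⟦ x ≡ᵇ b + n ⟧) (sym (⟦does⟧≡0 (x ≟ b) x≢b)) ⟩
  ⟦ x ≡ᵇ b ⟧ + ⟦ x ≡ᵇ b + n ⟧ ∎
  where
  n≤x : n ≤ x
  n≤x = ≮⇒≥ x≮n

  x∸n≡x%n : x ∸ n ≡ x % n
  x∸n≡x%n = trans (sym (m<n⇒m%n≡m (+-cancelʳ-< _ _ n x∸n+n<n+n))) (m≤n⇒[n∸m]%m≡n%m n≤x)
    where
    x∸n+n<n+n : x ∸ n + n < n + n
    x∸n+n<n+n = subst (_< n + n) (sym (m∸n+n≡m n≤x)) x<2n

  x≢b : x ≢ b
  x≢b x≡b = <-irrefl (sym x≡b) (<-≤-trans b<n n≤x)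

  to : x ∸ n ≡ b → x ≡ b + n
  to eq = trans (sym (m∸n+n≡m n≤x)) (cong (_+ n) eq)

  from : x ≡ b + n → x ∸ n ≡ b
  from eq = trans (cong (_∸ n) eq) (m+n∸n≡m b n)

⟦+suc≡⟧ : ∀ x c d → x < c → ⟦ x + suc d ≡ᵇ c ⟧ ≡ ⟦ c ∸ suc x ≡ᵇ d ⟧
⟦+suc≡⟧ x c d x<c = cong ⟦_⟧ (does-⇔ (mk⇔ to from) (x + suc d ≟ c) (c ∸ suc x ≟ d))
  where
  to : x + suc d ≡ c → c ∸ suc x ≡ d
  to eq = trans (cong (_∸ suc x) (trans (sym eq) (+-suc x d))) (m+n∸m≡n (suc x) d)

  from : c ∸ suc x ≡ d → x + suc d ≡ c
  from eq = trans (+-suc x d) (trans (cong (suc x +_) (sym eq)) (m+[n∸m]≡n x<c))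

-- `circAdj (suc m) j u v` reduces to `circAdjℕ (suc m) j (toℕ u) (toℕ v)`.
circAdjℕ : (n j : ℕ) .{{_ : NonZero n}} → ℕ → ℕ → Bool
circAdjℕ n j a b = any (λ d → ((a + d) % n ≡ᵇ b) ∨ ((b + d) % n ≡ᵇ a)) (map suc (upTo j))

module Circulant (n j : ℕ) .{{_ : NonZero n}} (2j<n : 2 * j < n) where

  hits : ℕ → ℕ → ℕ
  hits a b = ∑[ d < j ] ⟦ (a + suc d) % n ≡ᵇ b ⟧

  j<n : j < n
  j<n = ≤-<-trans (m≤m+n j (j + 0)) 2j<n

  a+1+d<2n : ∀ {a d} → a < n → d < j → a + suc d < n + n
  a+1+d<2n a<n d<j = +-mono-<-≤ a<n (<-trans d<j j<n)

  hits-diagonal : ∀ a → a < n → hits a a ≡ 0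
  hits-diagonal a a<n = trans (∑-cong j term) (∑-zero j)
    where
    term : ∀ d → d < j → ⟦ (a + suc d) % n ≡ᵇ a ⟧ ≡ 0
    term d d<j = begin
      ⟦ (a + suc d) % n ≡ᵇ a ⟧
        ≡⟨ ⟦%≡⟧-split n (a + suc d) a (a+1+d<2n a<n d<j) a<n ⟩
      ⟦ a + suc d ≡ᵇ a ⟧ + ⟦ a + suc d ≡ᵇ a + n ⟧
        ≡⟨ cong₂ _+_ (⟦does⟧≡0 (a + suc d ≟ a) (λ eq → m≢1+m+n a (trans (sym eq) (+-suc a d))))
                     (⟦does⟧≡0 (a + suc d ≟ a + n)
                               (λ eq → <⇒≢ (≤-<-trans d<j j<n) (+-cancelˡ-≡ a _ _ eq))) ⟩
      0 ∎

  hits-< : ∀ a b → a < b → b < n → hits a b ≡ ⟦ does (b ∸ suc a <? j) ⟧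
  hits-< a b a<b b<n = trans (∑-cong j term) (∑-count j (b ∸ suc a))
    where
    term : ∀ d → d < j → ⟦ (a + suc d) % n ≡ᵇ b ⟧ ≡ ⟦ b ∸ suc a ≡ᵇ d ⟧
    term d d<j = begin
      ⟦ (a + suc d) % n ≡ᵇ b ⟧
        ≡⟨ ⟦%≡⟧-split n (a + suc d) b (a+1+d<2n (<-trans a<b b<n) d<j) b<n ⟩
      ⟦ a + suc d ≡ᵇ b ⟧ + ⟦ a + suc d ≡ᵇ b + n ⟧
        ≡⟨ cong₂ _+_ (⟦+suc≡⟧ a b d a<b)
                     (⟦does⟧≡0 (a + suc d ≟ b + n) (<⇒≢ (+-mono-<-≤ a<b (<-trans d<j j<n)))) ⟩
      ⟦ b ∸ suc a ≡ᵇ d ⟧ + 0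
        ≡⟨ +-identityʳ _ ⟩
      ⟦ b ∸ suc a ≡ᵇ d ⟧ ∎

  hits-> : ∀ a b → a < b → b < n → hits b a ≡ ⟦ does (a + n ∸ suc b <? j) ⟧
  hits-> a b a<b b<n = trans (∑-cong j term) (∑-count j (a + n ∸ suc b))
    where
    term : ∀ d → d < j → ⟦ (b + suc d) % n ≡ᵇ a ⟧ ≡ ⟦ a + n ∸ suc b ≡ᵇ d ⟧
    term d d<j = begin
      ⟦ (b + suc d) % n ≡ᵇ a ⟧
        ≡⟨ ⟦%≡⟧-split n (b + suc d) a (a+1+d<2n b<n d<j) (<-trans a<b b<n) ⟩
      ⟦ b + suc d ≡ᵇ a ⟧ + ⟦ b + suc d ≡ᵇ a + n ⟧
        ≡⟨ cong₂ _+_ (⟦does⟧≡0 (b + suc d ≟ a)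
                               (λ eq → <-irrefl (sym eq) (<-≤-trans a<b (m≤m+n b (suc d)))))
                     (⟦+suc≡⟧ b (a + n) d (<-≤-trans b<n (m≤n+m n a))) ⟩
      ⟦ a + n ∸ suc b ≡ᵇ d ⟧ ∎

  -- The forward distance b − a and the backward distance a + n − b add up to n > 2j.
  not-both-near : ∀ a b → a < b → b < n → ¬ (b ∸ suc a < j × a + n ∸ suc b < j)
  not-both-near a b a<b b<n (p<j , q<j) = <-irrefl refl (<-≤-trans 2j<n n≤2j)
    where
    p q : ℕ
    p = b ∸ suc a
    q = a + n ∸ suc b

    a+[1+p+1+q]≡a+n : a + (suc p + suc q) ≡ a + n
    a+[1+p+1+q]≡a+n = begin
      a + (suc p + suc q)  ≡⟨ +-suc a (p + suc q) ⟩
      suc a + (p + suc q)  ≡⟨ sym (+-assoc (suc a) p (suc q)) ⟩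
      suc a + p + suc q    ≡⟨ cong (_+ suc q) (m+[n∸m]≡n a<b) ⟩
      b + suc q            ≡⟨ +-suc b q ⟩
      suc b + q            ≡⟨ m+[n∸m]≡n (<-≤-trans b<n (m≤n+m n a)) ⟩
      a + n                ∎

    n≤2j : n ≤ 2 * j
    n≤2j = subst (_≤ 2 * j) (+-cancelˡ-≡ a _ _ a+[1+p+1+q]≡a+n)
                 (+-mono-≤ p<j (subst (suc q ≤_) (sym (+-identityʳ j)) q<j))

  ⟦circAdj⟧≡hits+hits : ∀ a b → a < b → b < n → ⟦ circAdjℕ n j a b ⟧ ≡ hits a b + hits b a
  ⟦circAdj⟧≡hits+hits a b a<b b<n =
    trans (⟦any-∨⟧ (forward a b) (forward b a) (map suc (upTo j)) ≤1) sum≡hits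
    where
    forward : ℕ → ℕ → ℕ → Bool
    forward x y d = (x + d) % n ≡ᵇ y

    sum≡hits : sum (map (λ d → ⟦ forward a b d ⟧ + ⟦ forward b a d ⟧) (map suc (upTo j))) ≡
               hits a b + hits b a
    sum≡hits = trans (sum-map-suc-upTo j _) (∑-distrib-+ j _ _)

    ≤1 : sum (map (λ d → ⟦ forward a b d ⟧ + ⟦ forward b a d ⟧) (map suc (upTo j))) ≤ 1
    ≤1 = subst (_≤ 1) (sym (trans sum≡hits (cong₂ _+_ (hits-< a b a<b b<n) (hits-> a b a<b b<n))))
               (⟦does⟧+⟦does⟧≤1 (b ∸ suc a <? j) (a + n ∸ suc b <? j) (not-both-near a b a<b b<n))

  -- Since 2j < n, every edge {a , b} is {u , (u + d) % n} for exactly one u < n and 1 ≤ d ≤ j.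
  ∑-edges≡∑-shifts : (g : ℕ → ℕ → ℕ) → (∀ a b → g a b ≡ g b a) →
    ∑[ a < n ] ∑[ b < n ] (⟦ does (a <? b) ⟧ * (⟦ circAdjℕ n j a b ⟧ * g a b)) ≡
    ∑[ u < n ] ∑[ d < j ] g u ((u + suc d) % n)
  ∑-edges≡∑-shifts g g-sym = sym (begin
    ∑[ u < n ] ∑[ d < j ] g u ((u + suc d) % n)
      ≡⟨ ∑-cong n (λ u _ → ∑-cong j (λ d _ →
           sym (∑-delta n ((u + suc d) % n) (g u) (m%n<n (u + suc d) n)))) ⟩
    ∑[ u < n ] ∑[ d < j ] ∑[ v < n ] (⟦ (u + suc d) % n ≡ᵇ v ⟧ * g u v)
      ≡⟨ ∑-cong n (λ u _ → ∑-comm j n (λ d v → ⟦ (u + suc d) % n ≡ᵇ v ⟧ * g u v)) ⟩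
    ∑[ u < n ] ∑[ v < n ] ∑[ d < j ] (⟦ (u + suc d) % n ≡ᵇ v ⟧ * g u v)
      ≡⟨ ∑-cong n (λ u _ → ∑-cong n (λ v _ →
           sym (*-distribʳ-∑ j (λ d → ⟦ (u + suc d) % n ≡ᵇ v ⟧) (g u v)))) ⟩
    ∑[ u < n ] ∑[ v < n ] (hits u v * g u v)
      ≡⟨ ∑∑-split-diagonal n (λ u v → hits u v * g u v) ⟩
    ∑[ a < n ] ∑[ b < n ] (⟦ does (a <? b) ⟧ * (hits a b * g a b + hits b a * g b a)) +
    ∑[ a < n ] (hits a a * g a a)
      ≡⟨ cong₂ _+_ (∑-cong n (λ a _ → ∑-cong n (λ b b<n → upper a b b<n))) diagonal≡0 ⟩
    ∑[ a < n ] ∑[ b < n ] (⟦ does (a <? b) ⟧ * (⟦ circAdjℕ n j a b ⟧ * g a b)) + 0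
      ≡⟨ +-identityʳ _ ⟩
    ∑[ a < n ] ∑[ b < n ] (⟦ does (a <? b) ⟧ * (⟦ circAdjℕ n j a b ⟧ * g a b)) ∎)
    where
    upper : ∀ a b → b < n → ⟦ does (a <? b) ⟧ * (hits a b * g a b + hits b a * g b a) ≡
                            ⟦ does (a <? b) ⟧ * (⟦ circAdjℕ n j a b ⟧ * g a b)
    upper a b b<n = ⟦does⟧*-cong (a <? b) (λ a<b → begin
      hits a b * g a b + hits b a * g b a ≡⟨ cong (λ x → hits a b * g a b + hits b a * x) (g-sym b a) ⟩
      hits a b * g a b + hits b a * g a b ≡⟨ sym (*-distribʳ-+ (g a b) (hits a b) (hits b a)) ⟩
      (hits a b + hits b a) * g a b       ≡⟨ cong (λ x → x * g a b) (sym (⟦circAdj⟧≡hits+hits a b a<b b<n)) ⟩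
      ⟦ circAdjℕ n j a b ⟧ * g a b        ∎)

    diagonal≡0 : ∑[ a < n ] (hits a a * g a a) ≡ 0
    diagonal≡0 = trans (∑-cong n (λ a a<n → cong (λ x → x * g a a) (hits-diagonal a a<n))) (∑-zero n)

∑-shifts-handshake : ∀ n .{{_ : NonZero n}} j (F : ℕ → ℕ) →
  ∑[ u < n ] ∑[ d < j ] (F u + F ((u + suc d) % n)) ≡ j * ∑ n F * 2
∑-shifts-handshake n j F = begin
  ∑[ u < n ] ∑[ d < j ] (F u + F ((u + suc d) % n))
    ≡⟨ ∑-comm n j _ ⟩
  ∑[ d < j ] ∑[ u < n ] (F u + F ((u + suc d) % n))
    ≡⟨ ∑-cong j (λ d _ → trans (∑-distrib-+ n F _) (cong (∑ n F +_) (∑-rotate n (suc d) F))) ⟩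
  ∑[ d < j ] (∑ n F + ∑ n F)
    ≡⟨ ∑-const j _ ⟩
  j * (∑ n F + ∑ n F)
    ≡⟨ cong (j *_) (cong (∑ n F +_) (sym (+-identityʳ (∑ n F)))) ⟩
  j * (2 * ∑ n F)
    ≡⟨ cong (j *_) (*-comm 2 (∑ n F)) ⟩
  j * (∑ n F * 2)
    ≡⟨ sym (*-assoc j (∑ n F) 2) ⟩
  j * ∑ n F * 2 ∎

shiftCount : (n j : ℕ) .{{_ : NonZero n}} (F : ℕ → ℕ) → ℕ → ℕ
shiftCount n j F i = ∑[ u < n ] ∑[ d < j ] edgeLabelIs F i u ((u + suc d) % n)

shiftCount-0+1 : ∀ n j .{{_ : NonZero n}} F → shiftCount n j F 0 + shiftCount n j F 1 ≡ n * j
shiftCount-0+1 n j F = begin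
  shiftCount n j F 0 + shiftCount n j F 1   ≡⟨ sym (∑∑-distrib-+ n j (shiftLabelIs 0) (shiftLabelIs 1)) ⟩
  ∑[ u < n ] ∑[ d < j ] (shiftLabelIs 0 u d + shiftLabelIs 1 u d)
    ≡⟨ ∑-cong n (λ u _ → trans (∑-cong j (λ d _ → edgeLabelIs-0+1 F u _))
                               (trans (∑-const j 1) (*-identityʳ j))) ⟩
  ∑[ u < n ] j                              ≡⟨ ∑-const n j ⟩
  n * j                                     ∎
  where
  shiftLabelIs : ℕ → ℕ → ℕ → ℕ
  shiftLabelIs i u d = edgeLabelIs F i u ((u + suc d) % n)

shiftCount-1-even : ∀ n j .{{_ : NonZero n}} F → shiftCount n j F 1 % 2 ≡ 0
shiftCount-1-even n j F = begin
  shiftCount n j F 1 % 2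
    ≡⟨ cong (_% 2) (∑-cong n (λ u _ → ∑-cong j (λ d _ → edgeLabelIs-1 F u _))) ⟩
  ∑[ u < n ] ∑[ d < j ] ((F u + F ((u + suc d) % n)) % 2) % 2
    ≡⟨ ∑∑-% n j (λ u d → F u + F ((u + suc d) % n)) 2 ⟩
  ∑[ u < n ] ∑[ d < j ] (F u + F ((u + suc d) % n)) % 2
    ≡⟨ cong (_% 2) (∑-shifts-handshake n j F) ⟩
  j * ∑ n F * 2 % 2
    ≡⟨ m*n%n≡0 (j * ∑ n F) 2 ⟩
  0 ∎

-- Residues modulo 4

%4%2≡%2 : ∀ N → N % 4 % 2 ≡ N % 2
%4%2≡%2 N = m∣n⇒o%n%m≡o%m 2 4 N (divides 2 refl)

%2≡1⇒%4≢2 : ∀ N → N % 2 ≡ 1 → N % 4 ≢ 2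
%2≡1⇒%4≢2 N N%2≡1 N%4≡2 with () ← trans (sym N%2≡1) (trans (sym (%4%2≡%2 N)) (cong (_% 2) N%4≡2))

[1+t+t]%2≡1 : ∀ t → suc (t + t) % 2 ≡ 1
[1+t+t]%2≡1 t = trans (cong (λ x → suc x % 2) t+t≡t*2) ([m+kn]%n≡m%n 1 t 2)
  where
  t+t≡t*2 : t + t ≡ t * 2
  t+t≡t*2 = trans (cong (t +_) (sym (+-identityʳ t))) (*-comm 2 t)

even⇒[t+t]%4≡0 : ∀ t → t % 2 ≡ 0 → (t + t) % 4 ≡ 0
even⇒[t+t]%4≡0 t t%2≡0 = trans (cong (_% 4) t+t≡q*4) (m*n%n≡0 q 4)
  where
  q : ℕ
  q = t / 2

  t≡q*2 : t ≡ q * 2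
  t≡q*2 = trans (m≡m%n+[m/n]*n t 2) (cong (_+ q * 2) t%2≡0)

  t+t≡q*4 : t + t ≡ q * 4
  t+t≡q*4 = trans (cong₂ _+_ t≡q*2 t≡q*2) (sym (*-distribˡ-+ q 2 2))

near-equal-split⇒%4≢2 : ∀ s t → t % 2 ≡ 0 → s ≤ suc t → t ≤ suc s → (s + t) % 4 ≢ 2
near-equal-split⇒%4≢2 s t t-even s≤1+t t≤1+s with <-cmp s t
... | tri< s<t _ _ = %2≡1⇒%4≢2 (s + t)
  (trans (cong (λ x → (s + x) % 2) (≤-antisym t≤1+s s<t)) (trans (cong (_% 2) (+-suc s s)) ([1+t+t]%2≡1 s)))
... | tri≈ _ refl _ = λ [t+t]%4≡2 → 0≢1+n (trans (sym (even⇒[t+t]%4≡0 t t-even)) [t+t]%4≡2)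
... | tri> _ _ t<s = %2≡1⇒%4≢2 (s + t)
  (trans (cong (λ x → (x + t) % 2) (≤-antisym s≤1+t t<s)) ([1+t+t]%2≡1 t))

nj%4≡2 : ∀ n j → (j % 4 ≡ 2 × n % 2 ≡ 1) ⊎ (j % 4 ≡ 3 × n % 4 ≡ 2) → n * j % 4 ≡ 2
nj%4≡2 n j (inj₁ (j%4≡2 , n%2≡1)) = begin
  n * j % 4             ≡⟨ %-distribˡ-* n j 4 ⟩
  n % 4 * (j % 4) % 4   ≡⟨ cong (λ r → n % 4 * r % 4) j%4≡2 ⟩
  n % 4 * 2 % 4         ≡⟨ odd*2%4≡2 (n % 4) (m%n<n n 4) (trans (%4%2≡%2 n) n%2≡1) ⟩
  2                     ∎
  where
  odd*2%4≡2 : ∀ r → r < 4 → r % 2 ≡ 1 → r * 2 % 4 ≡ 2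
  odd*2%4≡2 1 _ _ = refl
  odd*2%4≡2 3 _ _ = refl
  odd*2%4≡2 (suc (suc (suc (suc _)))) (s≤s (s≤s (s≤s (s≤s ())))) _
nj%4≡2 n j (inj₂ (j%4≡3 , n%4≡2)) = trans (%-distribˡ-* n j 4) (cong₂ (λ r s → r * s % 4) n%4≡2 j%4≡3)

mainTheorem8 : (n j : ℕ) → 1 ≤ j → 2 * j < n →
    ((j % 4 ≡ 2 × n % 2 ≡ 1) ⊎ (j % 4 ≡ 3 × n % 4 ≡ 2)) →
    ¬ FibonacciCordial (circulant n j)
mainTheorem8 zero      j _ ()
mainTheorem8 n@(suc _) j _ 2j<n residues (f , _ , ε₀≤1+ε₁ , ε₁≤1+ε₀) =
  near-equal-split⇒%4≢2 (ε G f 0) (ε G f 1) ε₁-even ε₀≤1+ε₁ ε₁≤1+ε₀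
    (subst (λ x → x % 4 ≡ 2) (sym ε₀+ε₁≡nj) (nj%4≡2 n j residues))
  where
  G : Graph
  G = circulant n j

  F : ℕ → ℕ
  F a = fib (toℕ (f (a mod n)))

  F≗ : ∀ u → fib (toℕ (f u)) ≡ F (toℕ u)
  F≗ u = cong (fib ∘ toℕ ∘ f) (sym toℕ-mod)
    where
    toℕ-mod : toℕ u mod n ≡ u
    toℕ-mod = toℕ-injective (trans (toℕ-fromℕ< _) (m<n⇒m%n≡m (toℕ<n u)))

  ε≡shiftCount : ∀ i → ε G f i ≡ shiftCount n j F i
  ε≡shiftCount i = trans (ε≡∑ G (circAdjℕ n j) (λ _ _ → refl) f F F≗ i)
                         (Circulant.∑-edges≡∑-shifts n j 2j<n (edgeLabelIs F i) (edgeLabelIs-sym F i))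

  ε₀+ε₁≡nj : ε G f 0 + ε G f 1 ≡ n * j
  ε₀+ε₁≡nj = trans (cong₂ _+_ (ε≡shiftCount 0) (ε≡shiftCount 1)) (shiftCount-0+1 n j F)

  ε₁-even : ε G f 1 % 2 ≡ 0
  ε₁-even = trans (cong (_% 2) (ε≡shiftCount 1)) (shiftCount-1-even n j F)
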